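{- Let $n\ge 2$, let $\Gamma$ be an abelian group, and let $K\le \Gamma$ be a subgroup together with an isomorphism identifying $K$ with $\mathbb{F}_2^n$. Let $\boldsymbol{e}_1,\dots,\boldsymbol{e}_n$ denote the elements of $K$ corresponding to the standard basis vectors of $\mathbb{F}_2^n$, and write $D_n=\{\boldsymbol{e}_i+\boldsymbol{e}_j:1\le i<j\le n\}\subseteq K$. Let $u$ be an integer with $0\le u\le n$. Suppose that $X\subseteq C\subseteq \Gamma$, $|X|\le n-u$, and $D_n\subseteq X-C$. Then $|C|\ge n+\binom{u}{2}$.
   Context: $X-C=\{x-c: x\in X,\ c\in C\}$. -}

module Defs where

open import Level using (Level; _⊔_)
open import Data.Bool using (Bool; _xor_)
open import Data.Nat using (ℕ)
open import Data.Fin using (Fin; _≟_)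
open import Data.Vec using (Vec; zipWith; tabulate)
open import Data.List using (List)
open import Data.Product using (Σ; _×_)
open import Relation.Nullary.Decidable using (isYes)
open import Relation.Binary.PropositionalEquality using (_≡_)
open import Algebra.Bundles using (AbelianGroup)
import Data.List.Membership.Setoid as SetMem
import Data.List.Relation.Unary.Unique.Setoid as SetUnique
import Data.List.Relation.Binary.Subset.Setoid as SetSubset

F2^ : ℕ → Set
F2^ n = Vec Bool n

_⊕_ : ∀ {n} → F2^ n → F2^ n → F2^ n
_⊕_ = zipWith _xor_

basis : ∀ {n} → Fin n → F2^ n
basis i = tabulate (λ j → isYes (i ≟ j))

module _ {c ℓ : Level} (G : AbelianGroup c ℓ) where
  open AbelianGroup G

  _-ᴳ_ : Carrier → Carrier → Carrier
  x -ᴳ y = x ∙ (y ⁻¹)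

  -- An injective group homomorphism ι : F₂ⁿ → Γ; its image is the subgroup K ≤ Γ,
  -- and ι is the isomorphism F₂ⁿ ≅ K.
  record F2Embedding (n : ℕ) : Set (c ⊔ ℓ) where
    field
      ι       : F2^ n → Carrier
      hom     : ∀ v w → ι (v ⊕ w) ≈ (ι v ∙ ι w)
      inj     : ∀ v w → ι v ≈ ι w → v ≡ w

    e : Fin n → Carrier
    e i = ι (basis i)

  -- finite subsets of Γ as duplicate-free lists (up to ≈); cardinality = length
  _∈ᴳ_ : Carrier → List Carrier → Set (c ⊔ ℓ)
  _∈ᴳ_ = SetMem._∈_ setoid

  _⊆ᴳ_ : List Carrier → List Carrier → Set (c ⊔ ℓ)
  _⊆ᴳ_ = SetSubset._⊆_ setoid

  Distinct : List Carrier → Set (c ⊔ ℓ)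
  Distinct = SetUnique.Unique setoid

  InDiff : Carrier → List Carrier → List Carrier → Set (c ⊔ ℓ)
  InDiff d X C = Σ Carrier (λ x → Σ Carrier (λ y →
    (x ∈ᴳ X) × (y ∈ᴳ C) × (d ≈ (x -ᴳ y))))

-- For W ⊆ [n] call x, y ∈ Γ W-congruent when x - y lies in the subgroup generated by the
-- e_a with a ∈ W. Starting from W = [n], add the elements of X one at a time, each time deleting
-- from W one coordinate of the difference to the (unique) earlier element the new one is
-- congruent to; this yields W with |W| > n - |X| on which the elements of X are pairwise
-- incongruent. For i < j in W write e_i + e_j = x_ij - y_ij with x_ij ∈ X and y_ij ∈ C:
-- incongruence forces the y_ij to be pairwise distinct and to avoid X, so
-- |C| ≥ |X| + C(|W|,2) ≥ n + C(u,2).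
-- Choosing W needs excluded middle for congruence; this is harmless because the conclusion
-- is a decidable inequality of naturals.
module Submission where

open import Defs
open import Data.Nat using (ℕ; _≤_; _<_; _+_)
open import Data.Nat.Combinatorics using (_C_)
open import Data.Fin using (Fin; toℕ)
open import Data.List using (List; length)
open import Algebra.Bundles using (AbelianGroup)

open import Level using (_⊔_)
open import Function using (_∘_)
open import Algebra.Bundles using (Group)
open import Data.Bool.Properties using (xor-same; xor-comm)
open import Data.Nat using (suc; _∸_; _≤?_; z≤n; s≤s; _≤′_; ≤′-refl; ≤′-step)
open import Data.Nat.Properties
  using (≤-refl; ≤-reflexive; ≤-trans; <-≤-trans; n≤1+n; m<n⇒m<1+n; m≤n+m; ≤⇒≤′;
         +-assoc; +-suc; +-monoʳ-≤; +-cancelˡ-≤; +-cancelˡ-<; m+n≤o⇒m≤o; m+[n∸m]≡n;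
         module ≤-Reasoning)
open import Data.Nat.Combinatorics using (nCk+nC[k+1]≡[n+1]C[k+1]; nC1≡n)
open import Data.Fin using (zero; suc)
open import Data.Fin.Properties using (_≟_; suc-injective; <⇒≢; <-asym)
open import Data.Fin.Subset using (∣_∣)
open import Data.Vec.Properties using (zipWith-comm; tabulate-cong; tabulate∘lookup; lookup-replicate)
open import Data.Product using (Σ; ∃; _×_; _,_; proj₁; proj₂; uncurry)
open import Data.Sum using (_⊎_; inj₁; inj₂; [_,_])
import Data.Sum as Sum
open import Data.List using ([]; _∷_; map; _++_)
open import Data.List.Properties using (length-map; length-++; length-removeAt′)
open import Data.List.Relation.Unary.All as All using (All; []; _∷_)
import Data.List.Relation.Unary.All.Properties as All
open import Data.List.Relation.Unary.AllPairs as AllPairs using (AllPairs; []; _∷_)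
import Data.List.Relation.Unary.AllPairs.Properties as AllPairs
open import Data.List.Relation.Unary.Any using (here; there; index)
open import Relation.Binary.Bundles using (Setoid)
open import Relation.Binary.Core using (Rel)
open import Relation.Binary.PropositionalEquality as ≡ using (_≡_; _≢_)
open import Relation.Nullary.Decidable using (⌊⌋-map′; decidable-stable)
open import Relation.Nullary.Negation using (¬_; contradiction; ¬¬-map)

[1+n]C2≡n+nC2 : ∀ n → suc n C 2 ≡ n + n C 2
[1+n]C2≡n+nC2 n = ≡.trans (≡.sym (nCk+nC[k+1]≡[n+1]C[k+1] n 1)) (≡.cong (_+ n C 2) (nC1≡n n))

m≤n⇒mC2≤nC2 : ∀ {m n} → m ≤ n → m C 2 ≤ n C 2
m≤n⇒mC2≤nC2 = mono ∘ ≤⇒≤′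
  where
  mono : ∀ {m n} → m ≤′ n → m C 2 ≤ n C 2
  mono ≤′-refl = ≤-refl
  mono {n = suc n} (≤′-step m≤′n) =
    ≤-trans (mono m≤′n) (≤-trans (m≤n+m (n C 2) n) (≤-reflexive (≡.sym ([1+n]C2≡n+nC2 n))))

-- With d = n - m we have u ≤ d < k, and C(k,2) ≥ C(d+1,2) = d + C(d,2).
n+uC2≤m+kC2 : ∀ m u n k → m + u ≤ n → n < m + k → n + u C 2 ≤ m + k C 2
n+uC2≤m+kC2 m u n k m+u≤n n<m+k = begin
  n + u C 2        ≡⟨ ≡.cong (_+ u C 2) n≡m+d ⟩
  m + d + u C 2    ≡⟨ +-assoc m d (u C 2) ⟩
  m + (d + u C 2)  ≤⟨ +-monoʳ-≤ m (+-monoʳ-≤ d (m≤n⇒mC2≤nC2 u≤d)) ⟩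
  m + (d + d C 2)  ≡⟨ ≡.cong (m +_) ([1+n]C2≡n+nC2 d) ⟨
  m + suc d C 2    ≤⟨ +-monoʳ-≤ m (m≤n⇒mC2≤nC2 d<k) ⟩
  m + k C 2        ∎
  where
  open ≤-Reasoning
  d = n ∸ m
  n≡m+d : n ≡ m + d
  n≡m+d = ≡.sym (m+[n∸m]≡n (m+n≤o⇒m≤o m m+u≤n))
  u≤d : u ≤ d
  u≤d = +-cancelˡ-≤ m u d (≡.subst (m + u ≤_) n≡m+d m+u≤n)
  d<k : d < k
  d<k = +-cancelˡ-< m d k (≡.subst (_< m + k) n≡m+d n<m+k)

module _ {a} {A : Set a} where
  open import Data.List.Membership.Propositional using (_∈_)
  open import Data.List.Membership.Propositional.Properties using (∈-++⁻; ∈-map⁻)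
  open import Data.List.Relation.Unary.Unique.Propositional using (Unique)
  import Data.List.Relation.Unary.Unique.Propositional.Properties as Unique

  pairs : List A → List (A × A)
  pairs []       = []
  pairs (x ∷ xs) = map (x ,_) xs ++ pairs xs

  length-pairs : ∀ xs → length (pairs xs) ≡ length xs C 2
  length-pairs []       = ≡.refl
  length-pairs (x ∷ xs) = begin
    length (map (x ,_) xs ++ pairs xs)          ≡⟨ length-++ (map (x ,_) xs) ⟩
    length (map (x ,_) xs) + length (pairs xs)  ≡⟨ ≡.cong₂ _+_ (length-map (x ,_) xs) (length-pairs xs) ⟩
    length xs + length xs C 2                   ≡⟨ [1+n]C2≡n+nC2 (length xs) ⟨
    suc (length xs) C 2                         ∎
    where open ≡.≡-Reasoning

  AllPairs⇒All-pairs : ∀ {r} {R : Rel A r} {xs} → AllPairs R xs → All (uncurry R) (pairs xs)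
  AllPairs⇒All-pairs []         = []
  AllPairs⇒All-pairs (rs ∷ rss) = All.++⁺ (All.map⁺ rs) (AllPairs⇒All-pairs rss)

  ∈-pairs⁻ : ∀ {x y xs} → (x , y) ∈ pairs xs → x ∈ xs
  ∈-pairs⁻ {xs = z ∷ zs} xy∈ with ∈-++⁻ (map (z ,_) zs) xy∈
  ... | inj₁ xy∈map   = here (≡.cong proj₁ (proj₂ (proj₂ (∈-map⁻ (z ,_) xy∈map))))
  ... | inj₂ xy∈pairs = there (∈-pairs⁻ xy∈pairs)

  pairs-unique : ∀ {xs} → Unique xs → Unique (pairs xs)
  pairs-unique []                  = []
  pairs-unique {x ∷ xs} (x∉xs ∷ u) =
    Unique.++⁺ (Unique.map⁺ (≡.cong proj₂) u) (pairs-unique u) disjoint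
    where
    disjoint : ∀ {v} → ¬ (v ∈ map (x ,_) xs × v ∈ pairs xs)
    disjoint (v∈map , v∈pairs) with ∈-map⁻ (x ,_) v∈map
    ... | _ , _ , ≡.refl = All.lookup x∉xs (∈-pairs⁻ v∈pairs) ≡.refl

module _ {a p b} {A : Set a} {P : A → Set p} {B : Set b} where

  length-reduce : (f : ∀ {x} → P x → B) {xs : List A} (pxs : All P xs) →
                  length (All.reduce f pxs) ≡ length xs
  length-reduce f []         = ≡.refl
  length-reduce f (px ∷ pxs) = ≡.cong suc (length-reduce f pxs)

  All-reduce⁺ : ∀ {q} {Q : B → Set q} {f : ∀ {x} → P x → B} → (∀ {x} (px : P x) → Q (f px)) →
                ∀ {xs} (pxs : All P xs) → All Q (All.reduce f pxs)
  All-reduce⁺ g []         = []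
  All-reduce⁺ g (px ∷ pxs) = g px ∷ All-reduce⁺ g pxs

module _ {a p c ℓ} {A : Set a} {P : A → Set p} (S : Setoid c ℓ) where
  open Setoid S using (_≈_) renaming (Carrier to B)
  open import Data.List.Relation.Unary.Unique.Propositional using (Unique)
  open import Data.List.Relation.Unary.Unique.Setoid S using () renaming (Unique to Unique≈)

  Unique-reduce⁺ : {f : ∀ {x} → P x → B} →
                   (∀ {x y} (px : P x) (py : P y) → f px ≈ f py → x ≡ y) →
                   ∀ {xs} → Unique xs → (pxs : All P xs) → Unique≈ (All.reduce f pxs)
  Unique-reduce⁺         f-inj []           []         = []
  Unique-reduce⁺ {f = f} f-inj (x∉xs ∷ u) (px ∷ pxs) = apart x∉xs pxs ∷ Unique-reduce⁺ f-inj u pxs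
    where
    apart : ∀ {ys} → All (_ ≢_) ys → (pys : All P ys) → All (λ v → ¬ f px ≈ v) (All.reduce f pys)
    apart []           []         = []
    apart (x≢y ∷ x≢ys) (py ∷ pys) = (x≢y ∘ f-inj px py) ∷ apart x≢ys pys

module _ {c ℓ} (S : Setoid c ℓ) where
  open Setoid S
  open import Data.List.Membership.Setoid S using (_∈_; _─_)
  open import Data.List.Relation.Unary.Unique.Setoid S using (Unique)

  ∈-─⁺ : ∀ {x y ys} (x∈ys : x ∈ ys) → ¬ x ≈ y → y ∈ ys → y ∈ ys ─ x∈ys
  ∈-─⁺ (here x≈z)   x≉y (here y≈z)   = contradiction (trans x≈z (sym y≈z)) x≉y
  ∈-─⁺ (here _)     _   (there y∈ys) = y∈ys
  ∈-─⁺ (there _)    _   (here y≈z)   = here y≈z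
  ∈-─⁺ (there x∈ys) x≉y (there y∈ys) = there (∈-─⁺ x∈ys x≉y y∈ys)

  unique⇒length≤ : ∀ {xs ys} → Unique xs → All (_∈ ys) xs → length xs ≤ length ys
  unique⇒length≤ []                        []               = z≤n
  unique⇒length≤ {_ ∷ xs} {ys} (x≉xs ∷ u) (x∈ys ∷ xs⊆ys) = begin
    suc (length xs)           ≤⟨ s≤s (unique⇒length≤ u xs⊆ys─x) ⟩
    suc (length (ys ─ x∈ys))  ≡⟨ length-removeAt′ ys (index x∈ys) ⟨
    length ys                 ∎
    where
    open ≤-Reasoning
    xs⊆ys─x : All (_∈ ys ─ x∈ys) xs
    xs⊆ys─x = All.zipWith (λ (y∈ys , x≉y) → ∈-─⁺ x∈ys x≉y y∈ys) (xs⊆ys , x≉xs)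

module _ where
  open import Data.Fin.Subset using (Subset; inside; outside; _∈_; _∉_; _⊆_; _-_; ⁅_⁆; ⊥)
  open import Data.Fin.Subset.Properties using (p─⊥≡p; x∈⁅x⁆; x∈⁅y⁆⇒x≡y; x≢y⇒x∉⁅y⁆; ∉⊥)
  open import Data.Vec using ([]; _∷_; here; there)

  ∣p∣≤1+∣p-x∣ : ∀ {n} (p : Subset n) x → ∣ p ∣ ≤ suc ∣ p - x ∣
  ∣p∣≤1+∣p-x∣ (inside  ∷ p) zero    = ≤-reflexive (≡.cong (suc ∘ ∣_∣) (≡.sym (p─⊥≡p p)))
  ∣p∣≤1+∣p-x∣ (outside ∷ p) zero    =
    ≤-trans (n≤1+n ∣ p ∣) (≤-reflexive (≡.cong (suc ∘ ∣_∣) (≡.sym (p─⊥≡p p))))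
  ∣p∣≤1+∣p-x∣ (inside  ∷ p) (suc x) = s≤s (∣p∣≤1+∣p-x∣ p x)
  ∣p∣≤1+∣p-x∣ (outside ∷ p) (suc x) = ∣p∣≤1+∣p-x∣ p x

  x∉p-x : ∀ {n} {p : Subset n} x → x ∉ p - x
  x∉p-x {p = _ ∷ _} (suc x) (there x∈p-x) = x∉p-x x x∈p-x

  elements : ∀ {n} → Subset n → List (Fin n)
  elements []            = []
  elements (inside  ∷ p) = zero ∷ map suc (elements p)
  elements (outside ∷ p) = map suc (elements p)

  length-elements : ∀ {n} (p : Subset n) → length (elements p) ≡ ∣ p ∣
  length-elements []            = ≡.refl
  length-elements (inside  ∷ p) = ≡.cong suc (≡.trans (length-map suc (elements p)) (length-elements p))
  length-elements (outside ∷ p) = ≡.trans (length-map suc (elements p)) (length-elements p)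

  ∈-elements : ∀ {n} (p : Subset n) → All (_∈ p) (elements p)
  ∈-elements []            = []
  ∈-elements (inside  ∷ p) = here ∷ All.map⁺ (All.map there (∈-elements p))
  ∈-elements (outside ∷ p) = All.map⁺ (All.map there (∈-elements p))

  PairIn : ∀ {n} → Subset n → Fin n → Fin n → Set
  PairIn p i j = i ∈ p × j ∈ p × toℕ i < toℕ j

  PairIn-suc : ∀ {n s} {p : Subset n} {is} → AllPairs (PairIn p) is → AllPairs (PairIn (s ∷ p)) (map suc is)
  PairIn-suc = AllPairs.map⁺ ∘ AllPairs.map λ (i∈p , j∈p , i<j) → there i∈p , there j∈p , s≤s i<j

  elements-increasing : ∀ {n} (p : Subset n) → AllPairs (PairIn p) (elements p)
  elements-increasing []            = []
  elements-increasing (inside  ∷ p) =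
    All.map⁺ (All.map (λ j∈p → here , there j∈p , s≤s z≤n) (∈-elements p))
    ∷ PairIn-suc (elements-increasing p)
  elements-increasing (outside ∷ p) = PairIn-suc (elements-increasing p)

  ⊕-self : ∀ {n} (v : F2^ n) → v ⊕ v ≡ ⊥
  ⊕-self []      = ≡.refl
  ⊕-self (b ∷ v) = ≡.cong₂ _∷_ (xor-same b) (⊕-self v)

  ∈-⊕⁻ : ∀ {n x} (v w : F2^ n) → x ∈ v ⊕ w → x ∈ v ⊎ x ∈ w
  ∈-⊕⁻ (inside  ∷ v) (outside ∷ w) here       = inj₁ here
  ∈-⊕⁻ (outside ∷ v) (inside  ∷ w) here       = inj₂ here
  ∈-⊕⁻ (_       ∷ v) (_       ∷ w) (there x∈) = Sum.map there there (∈-⊕⁻ v w x∈)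

  ∈-⊕⁺ˡ : ∀ {n x} {v w : F2^ n} → x ∈ v → x ∉ w → x ∈ v ⊕ w
  ∈-⊕⁺ˡ {w = outside ∷ _} here        _   = here
  ∈-⊕⁺ˡ {w = inside  ∷ _} here        x∉w = contradiction here x∉w
  ∈-⊕⁺ˡ {w = _       ∷ _} (there x∈v) x∉w = there (∈-⊕⁺ˡ x∈v (x∉w ∘ there))

  ∈-⊕⁺ʳ : ∀ {n x} {v w : F2^ n} → x ∉ v → x ∈ w → x ∈ v ⊕ w
  ∈-⊕⁺ʳ {v = v} {w} x∉v x∈w = ≡.subst (_ ∈_) (zipWith-comm xor-comm w v) (∈-⊕⁺ˡ x∈w x∉v)

  basis≡⁅⁆ : ∀ {n} (i : Fin n) → basis i ≡ ⁅ i ⁆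
  basis≡⁅⁆ zero    = ≡.cong (inside ∷_)
    (≡.trans (tabulate-cong (λ j → ≡.sym (lookup-replicate j outside))) (tabulate∘lookup ⊥))
  basis≡⁅⁆ (suc i) = ≡.cong (outside ∷_)
    (≡.trans (tabulate-cong (λ j → ⌊⌋-map′ (≡.cong suc) suc-injective (i ≟ j))) (basis≡⁅⁆ i))

  basisPair : ∀ {n} → Fin n → Fin n → F2^ n
  basisPair i j = ⁅ i ⁆ ⊕ ⁅ j ⁆

  ∈-basisPair⁻ : ∀ {n} {x i j : Fin n} → x ∈ basisPair i j → x ≡ i ⊎ x ≡ j
  ∈-basisPair⁻ {i = i} {j} = Sum.map (x∈⁅y⁆⇒x≡y i) (x∈⁅y⁆⇒x≡y j) ∘ ∈-⊕⁻ ⁅ i ⁆ ⁅ j ⁆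

  basisPair-⊆ : ∀ {n} {p : Subset n} {i j} → i ∈ p → j ∈ p → basisPair i j ⊆ p
  basisPair-⊆ i∈p j∈p = [ (λ { ≡.refl → i∈p }) , (λ { ≡.refl → j∈p }) ] ∘ ∈-basisPair⁻

  i∈basisPair : ∀ {n} {i j : Fin n} → i ≢ j → i ∈ basisPair i j
  i∈basisPair {i = i} i≢j = ∈-⊕⁺ˡ (x∈⁅x⁆ i) (x≢y⇒x∉⁅y⁆ i≢j)

  j∈basisPair : ∀ {n} {i j : Fin n} → i ≢ j → j ∈ basisPair i j
  j∈basisPair {j = j} i≢j = ∈-⊕⁺ʳ (x≢y⇒x∉⁅y⁆ (i≢j ∘ ≡.sym)) (x∈⁅x⁆ j)

  basisPair≢⊥ : ∀ {n} {i j : Fin n} → i ≢ j → basisPair i j ≢ ⊥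
  basisPair≢⊥ i≢j eq = ∉⊥ (≡.subst (_ ∈_) eq (i∈basisPair i≢j))

  basisPair-injective : ∀ {n} {i j k l : Fin n} → toℕ i < toℕ j → toℕ k < toℕ l →
                        basisPair i j ≡ basisPair k l → i ≡ k × j ≡ l
  basisPair-injective {i = i} {j} i<j k<l eq
    with ∈-basisPair⁻ (≡.subst (i ∈_) eq (i∈basisPair (<⇒≢ i<j)))
       | ∈-basisPair⁻ (≡.subst (j ∈_) eq (j∈basisPair (<⇒≢ i<j)))
  ... | inj₁ i≡k    | inj₂ j≡l    = i≡k , j≡l
  ... | inj₁ i≡k    | inj₁ j≡k    = contradiction (≡.trans i≡k (≡.sym j≡k)) (<⇒≢ i<j)
  ... | inj₂ i≡l    | inj₂ j≡l    = contradiction (≡.trans i≡l (≡.sym j≡l)) (<⇒≢ i<j)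
  ... | inj₂ ≡.refl | inj₁ ≡.refl = contradiction k<l (<-asym i<j)

module _ {c ℓ} (G : AbelianGroup c ℓ) {n : ℕ} (E : F2Embedding G n) where
  open AbelianGroup G hiding (_-_)
  open Group group using (_//_)
  open F2Embedding E
  open import Algebra.Properties.AbelianGroup G
    using (∙-cancelˡ; inverseˡ-unique; ⁻¹-anti-homo-//; //-rightDividesˡ; //-cong₂; x∙y⁻¹≈ε⇒x≈y; x≈y⇒x∙y⁻¹≈ε)
  open import Relation.Binary.Reasoning.Setoid setoid
  open import Data.Fin.Subset using (Subset; _⊆_; _-_; ⁅_⁆; ⊤; ⊥) renaming (_∈_ to _∈ˢ_)
  open import Data.Fin.Subset.Properties using (p─q⊆p; nonempty?; Empty-unique; ∣⊤∣≡n)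
  open import Data.List.Membership.Setoid setoid using (_∈_; _∉_)
  open import Data.List.Membership.Setoid.Properties using (∈-resp-≈; ∉-resp-≈)
  import Data.List.Relation.Unary.Unique.Setoid.Properties as Unique
  open import Data.List.Relation.Unary.All.Properties using (All¬⇒¬Any)
  open import Relation.Nullary.Decidable using (Dec; yes; no; ¬¬-excluded-middle)
  open import Relation.Nullary.Negation using (¬¬-Monad)
  open import Effect.Monad using (RawMonad)

  ι-⊥ : ι ⊥ ≈ ε
  ι-⊥ = ∙-cancelˡ (ι ⊥) (ι ⊥) ε (begin
    ι ⊥ ∙ ι ⊥  ≈⟨ hom ⊥ ⊥ ⟨
    ι (⊥ ⊕ ⊥)  ≡⟨ ≡.cong ι (⊕-self ⊥) ⟩
    ι ⊥        ≈⟨ identityʳ (ι ⊥) ⟨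
    ι ⊥ ∙ ε    ∎)

  ι-selfInverse : ∀ v → ι v ⁻¹ ≈ ι v
  ι-selfInverse v = sym (inverseˡ-unique (ι v) (ι v) (begin
    ι v ∙ ι v  ≈⟨ hom v v ⟨
    ι (v ⊕ v)  ≡⟨ ≡.cong ι (⊕-self v) ⟩
    ι ⊥        ≈⟨ ι-⊥ ⟩
    ε          ∎))

  e∙e≈ι-basisPair : ∀ i j → e i ∙ e j ≈ ι (basisPair i j)
  e∙e≈ι-basisPair i j = begin
    e i ∙ e j              ≈⟨ hom (basis i) (basis j) ⟨
    ι (basis i ⊕ basis j)  ≡⟨ ≡.cong ι (≡.cong₂ _⊕_ (basis≡⁅⁆ i) (basis≡⁅⁆ j)) ⟩
    ι (basisPair i j)      ∎

  infix 4 _∈⟨_⟩ _∼⟨_⟩_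

  _∈⟨_⟩ : Carrier → Subset n → Set ℓ
  g ∈⟨ W ⟩ = Σ (F2^ n) λ v → v ⊆ W × g ≈ ι v

  ∈⟨⟩-resp-≈ : ∀ {W g h} → g ≈ h → g ∈⟨ W ⟩ → h ∈⟨ W ⟩
  ∈⟨⟩-resp-≈ g≈h (v , v⊆W , g≈ιv) = v , v⊆W , trans (sym g≈h) g≈ιv

  ∈⟨⟩-mono : ∀ {W W′ g} → W ⊆ W′ → g ∈⟨ W ⟩ → g ∈⟨ W′ ⟩
  ∈⟨⟩-mono W⊆W′ (v , v⊆W , g≈ιv) = v , W⊆W′ ∘ v⊆W , g≈ιv

  ∈⟨⟩-∙ : ∀ {W g h} → g ∈⟨ W ⟩ → h ∈⟨ W ⟩ → g ∙ h ∈⟨ W ⟩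
  ∈⟨⟩-∙ (v , v⊆W , g≈ιv) (w , w⊆W , h≈ιw) =
    v ⊕ w , [ v⊆W , w⊆W ] ∘ ∈-⊕⁻ v w , trans (∙-cong g≈ιv h≈ιw) (sym (hom v w))

  ∈⟨⟩-⁻¹ : ∀ {W g} → g ∈⟨ W ⟩ → g ⁻¹ ∈⟨ W ⟩
  ∈⟨⟩-⁻¹ (v , v⊆W , g≈ιv) = v , v⊆W , trans (⁻¹-cong g≈ιv) (ι-selfInverse v)

  _∼⟨_⟩_ : Carrier → Subset n → Carrier → Set ℓ
  x ∼⟨ W ⟩ y = x // y ∈⟨ W ⟩

  ∼-resp-≈ : ∀ {W x x′ y y′} → x ≈ x′ → y ≈ y′ → x ∼⟨ W ⟩ y → x′ ∼⟨ W ⟩ y′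
  ∼-resp-≈ x≈x′ y≈y′ = ∈⟨⟩-resp-≈ (//-cong₂ x≈x′ y≈y′)

  ∼-sym : ∀ {W x y} → x ∼⟨ W ⟩ y → y ∼⟨ W ⟩ x
  ∼-sym {x = x} {y} = ∈⟨⟩-resp-≈ (⁻¹-anti-homo-// x y) ∘ ∈⟨⟩-⁻¹

  ∼-trans : ∀ {W x y z} → x ∼⟨ W ⟩ y → y ∼⟨ W ⟩ z → x ∼⟨ W ⟩ z
  ∼-trans {x = x} {y} {z} x∼y y∼z = ∈⟨⟩-resp-≈ telescope (∈⟨⟩-∙ x∼y y∼z)
    where
    telescope : (x // y) ∙ (y // z) ≈ x // z
    telescope = begin
      (x // y) ∙ (y ∙ z ⁻¹)  ≈⟨ assoc (x // y) y (z ⁻¹) ⟨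
      (x // y) ∙ y ∙ z ⁻¹    ≈⟨ ∙-congʳ (//-rightDividesˡ y x) ⟩
      x ∙ z ⁻¹               ∎

  Separated : Subset n → List Carrier → Set (c ⊔ ℓ)
  Separated W X = ∀ {x y} → x ∈ X → y ∈ X → x ∼⟨ W ⟩ y → x ≈ y

  separated-mono : ∀ {W W′ X} → W ⊆ W′ → Separated W′ X → Separated W X
  separated-mono W⊆W′ sep x∈X y∈X = sep x∈X y∈X ∘ ∈⟨⟩-mono W⊆W′

  separated-∷ : ∀ {W x ys} → Separated W ys → (∀ {y} → y ∈ ys → ¬ x ∼⟨ W ⟩ y) → Separated W (x ∷ ys)
  separated-∷ sep fresh (here x′≈x)  (here y′≈x)  _    = trans x′≈x (sym y′≈x)
  separated-∷ sep fresh (here x′≈x)  (there y∈ys) x′∼y =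
    contradiction (∼-resp-≈ x′≈x refl x′∼y) (fresh y∈ys)
  separated-∷ sep fresh (there x∈ys) (here y′≈x)  x∼y′ =
    contradiction (∼-sym (∼-resp-≈ refl y′≈x x∼y′)) (fresh x∈ys)
  separated-∷ sep fresh (there x∈ys) (there y∈ys) x∼y  = sep x∈ys y∈ys x∼y

  -- z is the only element of ys congruent to x; deleting a coordinate a of x - z makes
  -- x ∼ y impossible, since it would force y ≈ z and hence x - y = x - z, whose support contains a.
  separated-shrink : ∀ {W x z ys} → x ∉ ys → Separated W ys → z ∈ ys → x ∼⟨ W ⟩ z →
                     ∃ λ a → a ∈ˢ W × Separated (W - a) (x ∷ ys)
  separated-shrink {W} {x} {z} {ys} x∉ys sep z∈ys x∼z@(v , v⊆W , x//z≈ιv) with nonempty? v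
  ... | no ∄a = contradiction (∈-resp-≈ setoid (sym x≈z) z∈ys) x∉ys
    where
    x≈z : x ≈ z
    x≈z = x∙y⁻¹≈ε⇒x≈y x z (begin
      x // z  ≈⟨ x//z≈ιv ⟩
      ι v     ≡⟨ ≡.cong ι (Empty-unique ∄a) ⟩
      ι ⊥     ≈⟨ ι-⊥ ⟩
      ε       ∎)
  ... | yes (a , a∈v) = a , v⊆W a∈v , separated-∷ (separated-mono W-a⊆W sep) fresh
    where
    W-a⊆W : W - a ⊆ W
    W-a⊆W = p─q⊆p W ⁅ a ⁆
    fresh : ∀ {y} → y ∈ ys → ¬ x ∼⟨ W - a ⟩ y
    fresh {y} y∈ys x∼y@(w , w⊆W-a , x//y≈ιw) = x∉p-x a (w⊆W-a (≡.subst (a ∈ˢ_) v≡w a∈v))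
      where
      z≈y : z ≈ y
      z≈y = sep z∈ys y∈ys (∼-trans (∼-sym x∼z) (∈⟨⟩-mono W-a⊆W x∼y))
      v≡w : v ≡ w
      v≡w = inj v w (begin
        ι v     ≈⟨ x//z≈ιv ⟨
        x // z  ≈⟨ //-cong₂ refl z≈y ⟩
        x // y  ≈⟨ x//y≈ιw ⟩
        ι w     ∎)

  Separator : List Carrier → Set (c ⊔ ℓ)
  Separator X = Σ (Subset n) λ W → Separated W X × n < length X + ∣ W ∣

  separator-∷ : ∀ {x ys} → x ∉ ys → (S : Separator ys) →
                Dec (∃ λ y → y ∈ ys × x ∼⟨ proj₁ S ⟩ y) → Separator (x ∷ ys)
  separator-∷ {ys = ys} x∉ys (W , sep , n<) (yes (z , z∈ys , x∼z)) with separated-shrink x∉ys sep z∈ys x∼z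
  ... | a , a∈W , sep′ = W - a , sep′ ,
    <-≤-trans n< (≤-trans (+-monoʳ-≤ (length ys) (∣p∣≤1+∣p-x∣ W a))
                          (≤-reflexive (+-suc (length ys) ∣ W - a ∣)))
  separator-∷ x∉ys (W , sep , n<) (no ∄z) =
    W , separated-∷ sep (λ y∈ys x∼y → ∄z (_ , y∈ys , x∼y)) , m<n⇒m<1+n n<

  separator : ∀ x ys → Distinct G (x ∷ ys) → ¬ ¬ Separator (x ∷ ys)
  separator x []       _                  ¬S = ¬S (⊤ , singleton , s≤s (≤-reflexive (≡.sym (∣⊤∣≡n n))))
    where
    singleton : Separated ⊤ (x ∷ [])
    singleton (here x′≈x) (here y′≈x) _ = trans x′≈x (sym y′≈x)
  separator x (y ∷ ys) (x≉ys ∷ distinct) = do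
    S   ← separator y ys distinct
    dec ← ¬¬-excluded-middle
    pure (separator-∷ (All¬⇒¬Any x≉ys) S dec)
    where open RawMonad ¬¬-Monad

  module _ {X Cs : List Carrier} {W : Subset n} (sep : Separated W X) where

    target : ∀ {d} → InDiff G d X Cs → Carrier
    target (_ , y , _) = y

    target∈Cs : ∀ {d} (p : InDiff G d X Cs) → target p ∈ Cs
    target∈Cs (_ , _ , _ , y∈Cs , _) = y∈Cs

    target-injective : ∀ {v w} → v ⊆ W → w ⊆ W → (p : InDiff G (ι v) X Cs) (q : InDiff G (ι w) X Cs) →
                       target p ≈ target q → v ≡ w
    target-injective {v} {w} v⊆W w⊆W (x , y , x∈X , _ , ιv≈x//y) (x′ , y′ , x′∈X , _ , ιw≈x′//y′) y≈y′ =
      inj v w (begin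
        ι v       ≈⟨ ιv≈x//y ⟩
        x // y    ≈⟨ //-cong₂ x≈x′ y≈y′ ⟩
        x′ // y′  ≈⟨ ιw≈x′//y′ ⟨
        ι w       ∎)
      where
      x≈x′ : x ≈ x′
      x≈x′ = sep x∈X x′∈X (∼-trans (v , v⊆W , sym ιv≈x//y)
                                    (∼-sym (∼-resp-≈ refl (sym y≈y′) (w , w⊆W , sym ιw≈x′//y′))))

    target∈X⇒≡⊥ : ∀ {v} → v ⊆ W → (p : InDiff G (ι v) X Cs) → target p ∈ X → v ≡ ⊥
    target∈X⇒≡⊥ {v} v⊆W (x , y , x∈X , _ , ιv≈x//y) y∈X = inj v ⊥ (begin
      ι v     ≈⟨ ιv≈x//y ⟩
      x // y  ≈⟨ x≈y⇒x∙y⁻¹≈ε (sep x∈X y∈X (v , v⊆W , sym ιv≈x//y)) ⟩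
      ε       ≈⟨ ι-⊥ ⟨
      ι ⊥     ∎)

    separated⇒length+C2≤ : Distinct G X → _⊆ᴳ_ G X Cs →
                           (∀ (i j : Fin n) → toℕ i < toℕ j → InDiff G (e i ∙ e j) X Cs) →
                           length X + ∣ W ∣ C 2 ≤ length Cs
    separated⇒length+C2≤ X-distinct X⊆Cs cover =
      ≤-trans (≤-reflexive (≡.sym length-X++Y))
              (unique⇒length≤ setoid (Unique.++⁺ setoid X-distinct Y-distinct X∩Y≡∅)
                                     (All.++⁺ (All.tabulateₛ setoid X⊆Cs) Y⊆Cs))
      where
      valid : All (uncurry (PairIn W)) (pairs (elements W))
      valid = AllPairs⇒All-pairs (elements-increasing W)

      pairDiff : ∀ {ij} → uncurry (PairIn W) ij → InDiff G (ι (uncurry basisPair ij)) X Cs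
      pairDiff {i , j} (_ , _ , i<j) with cover i j i<j
      ... | x , y , x∈X , y∈Cs , eiej≈x//y = x , y , x∈X , y∈Cs , trans (sym (e∙e≈ι-basisPair i j)) eiej≈x//y

      Y : List Carrier
      Y = All.reduce (target ∘ pairDiff) valid

      length-X++Y : length (X ++ Y) ≡ length X + ∣ W ∣ C 2
      length-X++Y = ≡.trans (length-++ X) (≡.cong (length X +_)
        (≡.trans (length-reduce (target ∘ pairDiff) valid)
        (≡.trans (length-pairs (elements W)) (≡.cong (_C 2) (length-elements W)))))

      Y-distinct : Distinct G Y
      Y-distinct = Unique-reduce⁺ setoid pairDiff-injective
        (pairs-unique (AllPairs.map (<⇒≢ ∘ proj₂ ∘ proj₂) (elements-increasing W))) valid
        where
        pairDiff-injective : ∀ {ij kl} (p : uncurry (PairIn W) ij) (q : uncurry (PairIn W) kl) →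
                             target (pairDiff p) ≈ target (pairDiff q) → ij ≡ kl
        pairDiff-injective p@(i∈W , j∈W , i<j) q@(k∈W , l∈W , k<l) =
          uncurry (≡.cong₂ _,_) ∘ basisPair-injective i<j k<l
          ∘ target-injective (basisPair-⊆ i∈W j∈W) (basisPair-⊆ k∈W l∈W) (pairDiff p) (pairDiff q)

      Y⊆Cs : All (_∈ Cs) Y
      Y⊆Cs = All-reduce⁺ (target∈Cs ∘ pairDiff) valid

      Y∩X≡∅ : All (_∉ X) Y
      Y∩X≡∅ = All-reduce⁺ (λ p@(i∈W , j∈W , i<j) →
        basisPair≢⊥ (<⇒≢ i<j) ∘ target∈X⇒≡⊥ (basisPair-⊆ i∈W j∈W) (pairDiff p)) valid

      X∩Y≡∅ : ∀ {v} → ¬ (v ∈ X × v ∈ Y)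
      X∩Y≡∅ (v∈X , v∈Y) = All.lookupₛ setoid (∉-resp-≈ setoid) Y∩X≡∅ v∈Y v∈X

lemma2p2 : ∀ {c ℓ} (G : AbelianGroup c ℓ) (n : ℕ) → 2 ≤ n →
    (E : F2Embedding G n) →
    (u : ℕ) → u ≤ n →
    (X Cs : List (AbelianGroup.Carrier G)) →
    Distinct G X → Distinct G Cs → _⊆ᴳ_ G X Cs →
    length X + u ≤ n →
    (∀ (i j : Fin n) → toℕ i < toℕ j →
      InDiff G (AbelianGroup._∙_ G (F2Embedding.e E i) (F2Embedding.e E j)) X Cs) →
    n + (u C 2) ≤ length Cs
lemma2p2 G _ (s≤s (s≤s _)) E u _ [] Cs _ _ _ _ cover with cover zero (suc zero) (s≤s z≤n)
... | _ , _ , () , _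
lemma2p2 G n _ E u _ (x ∷ X) Cs X-distinct _ X⊆Cs |X|+u≤n cover =
  decidable-stable (n + u C 2 ≤? length Cs) (¬¬-map bound (separator G E x X X-distinct))
  where
  bound : Separator G E (x ∷ X) → n + u C 2 ≤ length Cs
  bound (W , sep , n<|X|+|W|) =
    ≤-trans (n+uC2≤m+kC2 (length (x ∷ X)) u n ∣ W ∣ |X|+u≤n n<|X|+|W|)
            (separated⇒length+C2≤ G E sep X-distinct X⊆Cs cover)
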